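{- For any ordinals $\alpha,\beta$, $\mathbf{w}(\alpha\times(\beta+1))\le\mathbf{w}(\alpha\times\beta)+1$.
   Context: Ordinals are regarded as linear orders, and $\alpha\times\beta$ carries the product order: $(a,b)\le(a',b')$ iff $a\le a'$ and $b\le b'$. For a poset $P$ with no infinite antichains, $\mathbf{w}(P)$ is the rank of the tree $\mathrm{Inc}(P)$ of non-empty finite sequences of pairwise incomparable elements ordered by strict initial segment $\sqsubset$, i.e. the least ordinal $\gamma$ with some $f:\mathrm{Inc}(P)\to\gamma$ satisfying $s\sqsubset t\implies f(s)>f(t)$. -}

module Defs where

open import Level using (Level; suc; _⊔_)
open import Data.Product using (Σ; ∃; _×_; _,_; proj₁)
open import Data.Sum using (_⊎_; inj₁; inj₂)
open import Data.Unit.Polymorphic using (⊤)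
open import Data.Empty.Polymorphic using (⊥)
open import Data.List using (List; []; _++_)
open import Data.List.Relation.Unary.AllPairs using (AllPairs)
open import Relation.Binary.Core using (Rel)
open import Relation.Binary.Structures using (IsStrictTotalOrder)
open import Relation.Binary.PropositionalEquality using (_≡_; _≢_)
open import Relation.Nullary using (¬_)
open import Induction.WellFounded using (WellFounded)

-- An ordinal, regarded as a linear order: a type with a well-founded
-- strict total order (equality is propositional equality).
record Ordinal (ℓ : Level) : Set (suc ℓ) where
  field
    Carrier : Set ℓ
    _<_     : Rel Carrier ℓ
    isSTO   : IsStrictTotalOrder _≡_ _<_
    wf      : WellFounded _<_

open Ordinal public

-- The successor ordinal β + 1 : β followed by one new top element.
-- Only its carrier and strict order are needed.
Succ : ∀ {ℓ} → Set ℓ → Set ℓ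
Succ {ℓ} A = A ⊎ ⊤ {ℓ}

SuccLt : ∀ {ℓ} {A : Set ℓ} → Rel A ℓ → Rel (Succ A) ℓ
SuccLt _<_ (inj₁ a) (inj₁ b) = a < b
SuccLt _<_ (inj₁ a) (inj₂ _) = ⊤
SuccLt _<_ (inj₂ _) _        = ⊥

Le : ∀ {ℓ} {A : Set ℓ} → Rel A ℓ → Rel A ℓ
Le _<_ a b = (a < b) ⊎ (a ≡ b)

ProdLe : ∀ {ℓ} {A B : Set ℓ} → Rel A ℓ → Rel B ℓ → Rel (A × B) ℓ
ProdLe _<A_ _<B_ (a , b) (a' , b') = Le _<A_ a a' × Le _<B_ b b'

Incomparable : ∀ {ℓ} {P : Set ℓ} → Rel P ℓ → Rel P ℓ
Incomparable _≤_ x y = ¬ (x ≤ y) × ¬ (y ≤ x)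

Inc : ∀ {ℓ} (P : Set ℓ) → Rel P ℓ → Set ℓ
Inc P _≤_ = Σ (List P) (λ s → (s ≢ []) × AllPairs (Incomparable _≤_) s)

_⊏_ : ∀ {ℓ} {P : Set ℓ} {_≤_ : Rel P ℓ} → Rel (Inc P _≤_) ℓ
_⊏_ {P = P} s t = Σ (List P) (λ u → (u ≢ []) × (proj₁ t ≡ proj₁ s ++ u))

-- rank(T) ≤ γ  for the tree (T, ⊏) and a linear order (C, <):
-- there is f : T → C with  s ⊏ t ⇒ f(s) > f(t).
RankLE : ∀ {ℓ} (T : Set ℓ) → Rel T ℓ → (C : Set ℓ) → Rel C ℓ → Set ℓ
RankLE T _⊏T_ C _<C_ =
  Σ (T → C) (λ f → ∀ s t → s ⊏T t → f t <C f s)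

wLE : ∀ {ℓ} (P : Set ℓ) → Rel P ℓ → (C : Set ℓ) → Rel C ℓ → Set ℓ
wLE P _≤_ C _<C_ = RankLE (Inc P _≤_) (_⊏_ {_≤_ = _≤_}) C _<C_

_×ₚ_ : ∀ {ℓ} → Ordinal ℓ → Ordinal ℓ → Σ (Set ℓ) (λ P → Rel P ℓ)
α ×ₚ β = (Carrier α × Carrier β) , ProdLe (_<_ α) (_<_ β)

_×ₚsucc_ : ∀ {ℓ} → Ordinal ℓ → Ordinal ℓ → Σ (Set ℓ) (λ P → Rel P ℓ)
α ×ₚsucc β = (Carrier α × Succ (Carrier β)) , ProdLe (_<_ α) (SuccLt (_<_ β))

module Submission where

-- Write ∞ for the top point of β + 1.  Two points (a , ∞), (a' , ∞) are always
-- comparable because α is linear, so an incomparable sequence s in α × (β + 1)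
-- contains at most one point at height ∞.  Let  reduce s  be the sequence of
-- α × β obtained from s by deleting that point if there is one, and the last
-- point of s otherwise.  It is a sublist of s (minus its ∞-points), hence again
-- incomparable, and it is strictly prefix-monotone:  s ⊏ t  implies that
-- reduce s  is a strict prefix of  reduce t.  Given a rank function f into γ on
-- Inc(α × β), extend it to possibly empty incomparable sequences by sending the
-- empty one to the new top of γ + 1; composing this extension with  reduce
-- gives the required rank function into γ + 1.

open import Defs
open import Level using (Level)
open import Data.Product using (proj₁; proj₂; _,_; _×_; Σ)
open import Data.Sum using (inj₁; inj₂)
open import Data.Unit.Polymorphic using (tt)
open import Data.Empty using (⊥-elim)
open import Data.List using (List; []; _∷_; _++_)
open import Data.List.Relation.Unary.All using (All; []; _∷_)
open import Data.List.Relation.Unary.All.Properties using (++⁻ʳ)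
open import Data.List.Relation.Unary.AllPairs using (AllPairs; []; _∷_)
open import Data.List.Relation.Binary.Sublist.Propositional
  using (_⊆_; []; _∷_; _∷ʳ_; ⊆-refl)
open import Data.List.Relation.Binary.Sublist.Propositional.Properties
  using (All-resp-⊆)
open import Relation.Binary.Core using (Rel)
open import Relation.Binary.Definitions using (Trichotomous; tri<; tri≈; tri>)
open import Relation.Binary.Structures using (IsStrictTotalOrder)
open import Relation.Binary.PropositionalEquality using (_≡_; refl; _≢_; cong)
open import Relation.Nullary using (¬_)

_≺_ : ∀ {ℓ} {X : Set ℓ} → Rel (List X) ℓ
l ≺ l' = Σ _ λ u → (u ≢ []) × (l' ≡ l ++ u)

AllPairs-resp-⊆ : ∀ {ℓ} {X : Set ℓ} {R : Rel X ℓ} {xs ys : List X} →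
                  xs ⊆ ys → AllPairs R ys → AllPairs R xs
AllPairs-resp-⊆ []         []         = []
AllPairs-resp-⊆ (_ ∷ʳ σ)   (_ ∷ rys)  = AllPairs-resp-⊆ σ rys
AllPairs-resp-⊆ (refl ∷ σ) (ry ∷ rys) = All-resp-⊆ σ ry ∷ AllPairs-resp-⊆ σ rys

module RankExtension {ℓ} {P C : Set ℓ} (_≤_ : Rel P ℓ) (_<C_ : Rel C ℓ)
  (f : Inc P _≤_ → C) (f-anti : ∀ s t → _⊏_ {_≤_ = _≤_} s t → f t <C f s) where

  rank⁺ : (l : List P) → AllPairs (Incomparable _≤_) l → Succ C
  rank⁺ []       _  = inj₂ tt
  rank⁺ (x ∷ xs) ap = inj₁ (f (x ∷ xs , (λ ()) , ap))

  rank⁺-anti : ∀ {l l'} → l ≺ l' → (ap : AllPairs (Incomparable _≤_) l)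
               (ap' : AllPairs (Incomparable _≤_) l') →
               SuccLt _<C_ (rank⁺ l' ap') (rank⁺ l ap)
  rank⁺-anti {[]}     ([]    , u≢[] , _)    _  _   = ⊥-elim (u≢[] refl)
  rank⁺-anti {[]}     (_ ∷ _ , _    , refl) _  _   = tt
  rank⁺-anti {x ∷ xs} (u     , u≢[] , refl) ap ap' =
    f-anti (x ∷ xs , (λ ()) , ap) (x ∷ xs ++ u , (λ ()) , ap') (u , u≢[] , refl)

module Reduction {ℓ} {A B : Set ℓ} (_<A_ : Rel A ℓ) (_<B_ : Rel B ℓ)
  (compare : Trichotomous _≡_ _<A_) where

  _≤⁺_ : Rel (A × Succ B) ℓ
  _≤⁺_ = ProdLe _<A_ (SuccLt _<B_)

  _≤_ : Rel (A × B) ℓ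
  _≤_ = ProdLe _<A_ _<B_

  tops-comparable : ∀ {a a' t t'} → ¬ Incomparable _≤⁺_ (a , inj₂ t) (a' , inj₂ t')
  tops-comparable {a} {a'} (a≰a' , a'≰a) with compare a a'
  ... | tri< a<a' _ _ = a≰a' (inj₁ a<a' , inj₂ refl)
  ... | tri≈ _ a≡a' _ = a≰a' (inj₂ a≡a' , inj₂ refl)
  ... | tri> _ _ a'<a = a'≰a (inj₁ a'<a , inj₂ refl)

  embed-Le : ∀ {b b'} → Le _<B_ b b' → Le (SuccLt _<B_) (inj₁ b) (inj₁ b')
  embed-Le (inj₁ b<b') = inj₁ b<b'
  embed-Le (inj₂ refl) = inj₂ refl

  restrict-incomparable : ∀ {a b a' b'} →
    Incomparable _≤⁺_ (a , inj₁ b) (a' , inj₁ b') → Incomparable _≤_ (a , b) (a' , b')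
  restrict-incomparable (x≰y , y≰x) =
    (λ (a≤a' , b≤b') → x≰y (a≤a' , embed-Le b≤b')) ,
    (λ (a'≤a , b'≤b) → y≰x (a'≤a , embed-Le b'≤b))

  finite : List (A × Succ B) → List (A × B)
  finite []                  = []
  finite ((a , inj₁ b) ∷ xs) = (a , b) ∷ finite xs
  finite ((a , inj₂ _) ∷ xs) = finite xs

  finite-++ : ∀ xs ys → finite (xs ++ ys) ≡ finite xs ++ finite ys
  finite-++ []                  ys = refl
  finite-++ ((a , inj₁ b) ∷ xs) ys = cong ((a , b) ∷_) (finite-++ xs ys)
  finite-++ ((a , inj₂ _) ∷ xs) ys = finite-++ xs ys

  finite-incomparable : ∀ {xs} → AllPairs (Incomparable _≤⁺_) xs →
                        AllPairs (Incomparable _≤_) (finite xs)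
  finite-incomparable {[]}                  []         = []
  finite-incomparable {(a , inj₁ b) ∷ xs} (rx ∷ rxs) = finite-All rx ∷ finite-incomparable rxs
    where
    finite-All : ∀ {ys} → All (Incomparable _≤⁺_ (a , inj₁ b)) ys →
                 All (Incomparable _≤_ (a , b)) (finite ys)
    finite-All {[]}                  []       = []
    finite-All {(_ , inj₁ _) ∷ _} (r ∷ rs) = restrict-incomparable r ∷ finite-All rs
    finite-All {(_ , inj₂ _) ∷ _} (_ ∷ rs) = finite-All rs
  finite-incomparable {(a , inj₂ _) ∷ xs} (_ ∷ rxs)  = finite-incomparable rxs

  finite-nonempty : ∀ {a t} y ys → All (Incomparable _≤⁺_ (a , inj₂ t)) (y ∷ ys) →
                    finite (y ∷ ys) ≢ []
  finite-nonempty (_ , inj₁ _) _ _       = λ ()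
  finite-nonempty (_ , inj₂ _) _ (r ∷ _) = ⊥-elim (tops-comparable r)

  reduce : List (A × Succ B) → List (A × B)
  reduce []                       = []
  reduce ((a , inj₂ _) ∷ xs)      = finite xs
  reduce ((a , inj₁ b) ∷ [])      = []
  reduce ((a , inj₁ b) ∷ y ∷ xs)  = (a , b) ∷ reduce (y ∷ xs)

  reduce-⊆ : ∀ xs → reduce xs ⊆ finite xs
  reduce-⊆ []                      = []
  reduce-⊆ ((a , inj₂ _) ∷ xs)     = ⊆-refl
  reduce-⊆ ((a , inj₁ b) ∷ [])     = (a , b) ∷ʳ []
  reduce-⊆ ((a , inj₁ b) ∷ y ∷ xs) = refl ∷ reduce-⊆ (y ∷ xs)

  reduce-incomparable : ∀ {xs} → AllPairs (Incomparable _≤⁺_) xs →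
                        AllPairs (Incomparable _≤_) (reduce xs)
  reduce-incomparable {xs} ap = AllPairs-resp-⊆ (reduce-⊆ xs) (finite-incomparable ap)

  -- Extending a non-empty incomparable sequence strictly extends its reduction:
  -- the deleted point of x ∷ xs is either kept in the longer sequence, or (if
  -- at height ∞) the appended points are all finite.
  reduce-prefix : ∀ x xs y ys → AllPairs (Incomparable _≤⁺_) (x ∷ xs ++ y ∷ ys) →
                  reduce (x ∷ xs) ≺ reduce (x ∷ xs ++ y ∷ ys)
  reduce-prefix (a , inj₂ _) xs y ys (rx ∷ _) =
    finite (y ∷ ys) , finite-nonempty y ys (++⁻ʳ xs rx) , finite-++ xs (y ∷ ys)
  reduce-prefix (a , inj₁ b) []        y ys _ =
    (a , b) ∷ reduce (y ∷ ys) , (λ ()) , refl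
  reduce-prefix (a , inj₁ b) (x ∷ xs)  y ys (_ ∷ rxs)
    with u , u≢[] , eq ← reduce-prefix x xs y ys rxs = u , u≢[] , cong ((a , b) ∷_) eq

lemma4p9 : ∀ {ℓ : Level} (α β γ : Ordinal ℓ) →
    wLE (proj₁ (α ×ₚ β)) (proj₂ (α ×ₚ β)) (Carrier γ) (_<_ γ) →
    wLE (proj₁ (α ×ₚsucc β)) (proj₂ (α ×ₚsucc β)) (Succ (Carrier γ)) (SuccLt (_<_ γ))
lemma4p9 α β γ (f , f-anti) = g , g-anti
  where
  open Reduction (_<_ α) (_<_ β) (IsStrictTotalOrder.compare (isSTO α))
  open RankExtension _≤_ (_<_ γ) f f-anti

  g : Inc (proj₁ (α ×ₚsucc β)) _≤⁺_ → Succ (Carrier γ)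
  g (s , _ , ap) = rank⁺ (reduce s) (reduce-incomparable ap)

  g-anti : ∀ s t → _⊏_ {_≤_ = _≤⁺_} s t → SuccLt (_<_ γ) (g t) (g s)
  g-anti ([]     , s≢[] , _) _ _                        = ⊥-elim (s≢[] refl)
  g-anti (_      , _    , _) _ ([]     , u≢[] , _)      = ⊥-elim (u≢[] refl)
  g-anti (x ∷ xs , _    , ap) (_ , _ , ap') (y ∷ ys , _ , refl) =
    rank⁺-anti (reduce-prefix x xs y ys ap') (reduce-incomparable ap) (reduce-incomparable ap')
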